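{- Let $G$ be a finite group of order $n$ and let $\mathcal{A}\leq\mathbb{C}^\times$ be a finite subgroup. Let $R$ be the right regular representation of $G$, i.e. $R(g)=[\delta^{xg}_{y}]_{x,y\in G}$ for $g\in G$ (rows and columns indexed by $G$ in a fixed ordering). A matrix $M$ with entries in $\mathcal{A}$, rows and columns indexed by $G$, is group-developed over $G$ if and only if there exists a matrix that is $\mathcal{A}$-equivalent to $M$ and lies in the centraliser algebra $\mathrm{C}(R)=\{X\in M_n(\mathbb{C}) : XR(g)=R(g)X \text{ for all } g\in G\}$.
   Context: $\delta^a_b$ is the Kronecker delta. A matrix is monomial if it has exactly one nonzero entry in each row and column. Two matrices $M,M'$ are $\mathcal{A}$-equivalent if $M'=PMQ^{\ast}$ for monomial matrices $P,Q$ whose nonzero entries lie in $\mathcal{A}$ ($Q^\ast$ is the conjugate transpose). A matrix $M$ with entries in $\mathcal{A}$ is strictly group-developed over $G$ if there is a map $f\colon G\to\mathcal{A}$ with $M=[f(xy)]_{x,y\in G}$; it is group-developed over $G$ if it is $\mathcal{A}$-equivalent to a strictly group-developed matrix over $G$. -}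

module Defs where

open import Level using (0ℓ)
open import Data.Nat using (ℕ)
open import Data.Fin using (Fin)
open import Data.Fin.Permutation using (Permutation′; _⟨$⟩ʳ_)
open import Data.Integer using (ℤ; +_; _+_; _-_)
open import Data.Integer.Divisibility using (_∣_)
open import Data.Product using (Σ; _×_; ∃)
open import Relation.Binary.PropositionalEquality using (_≡_)
open import Algebra.Structures using (IsGroup)

-- A finite group of order n, with elements enumerated as Fin n
-- (this enumeration is the "fixed ordering" of rows/columns).
record FinGroup (n : ℕ) : Set where
  field
    _∙_    : Fin n → Fin n → Fin n
    ε      : Fin n
    _⁻¹    : Fin n → Fin n
    isGroup : IsGroup (_≡_ {A = Fin n}) _∙_ ε _⁻¹

-- The finite subgroup 𝒜 ≤ ℂ^× of order m is the group μ_m of m-th roots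
-- of unity, ζ = exp(2πi/m).  An element ζ^k of 𝒜 is represented by its
-- exponent k : ℤ; two exponents denote the same element iff they agree mod m.
-- Multiplication in 𝒜 is + on exponents, complex conjugation is negation.
_≈[_]_ : ℤ → ℕ → ℤ → Set
a ≈[ m ] b = (+ m) ∣ (a - b)

AMat : ℕ → Set
AMat n = Fin n → Fin n → ℤ

_≋[_]_ : {n : ℕ} → AMat n → ℕ → AMat n → Set
M ≋[ m ] N = ∀ x y → M x y ≈[ m ] N x y

-- A monomial matrix with nonzero entries in 𝒜: row x has its unique
-- nonzero entry ζ^(coeff x) in column (perm ⟨$⟩ʳ x).
record Monomial (n : ℕ) : Set where
  constructor mono
  field
    perm  : Permutation′ n
    coeff : Fin n → ℤ
open Monomial public

-- P M Q^*, computed entrywise: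
-- (P M Q^*)_{x,y} = P_{x,σx} M_{σx,τy} conj(Q_{y,τy}),
-- where σ = perm P, τ = perm Q; in exponents: p x + M(σx)(τy) − q y.
equivApply : {n : ℕ} → Monomial n → AMat n → Monomial n → AMat n
equivApply P M Q x y =
  coeff P x + M (perm P ⟨$⟩ʳ x) (perm Q ⟨$⟩ʳ y) - coeff Q y

AEquivalent : {n : ℕ} → ℕ → AMat n → AMat n → Set
AEquivalent {n} m M M' =
  Σ (Monomial n) λ P → Σ (Monomial n) λ Q → M' ≋[ m ] equivApply P M Q

module _ {n : ℕ} (G : FinGroup n) (m : ℕ) where
  open FinGroup G

  StrictlyGroupDeveloped : AMat n → Set
  StrictlyGroupDeveloped M = Σ (Fin n → ℤ) λ f → M ≋[ m ] (λ x y → f (x ∙ y))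

  GroupDeveloped : AMat n → Set
  GroupDeveloped M = Σ (AMat n) λ N → AEquivalent m M N × StrictlyGroupDeveloped N

  -- R(g) = [δ^{xg}_y] is a permutation matrix, so
  --   (X R(g))_{x,y} = X_{x, y g⁻¹}   and   (R(g) X)_{x,y} = X_{xg, y}.
  mulRightReg : AMat n → Fin n → AMat n
  mulRightReg X g x y = X x (y ∙ (g ⁻¹))

  mulLeftReg : Fin n → AMat n → AMat n
  mulLeftReg g X x y = X (x ∙ g) y

  InCentraliser : AMat n → Set
  InCentraliser X = ∀ g → mulRightReg X g ≋[ m ] mulLeftReg g X

module Submission where

open import Defs
open import Data.Nat using (ℕ; _≤_)
import Data.Nat.Divisibility as ℕ
open import Data.Fin.Permutation using (Permutation′; permutation; _∘ₚ_)
open import Data.Integer using (ℤ; +_; ∣_∣; _+_; _-_)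
open import Data.Integer.Properties using (+-inverseʳ; ∣i-j∣≡∣j-i∣)
import Data.Integer.Divisibility.Signed as Signed
open import Data.Integer.Tactic.RingSolver using (solve-∀)
open import Data.Product using (Σ; _×_; _,_)
open import Function.Bundles using (_⇔_; mk⇔)
open import Relation.Binary.Bundles using (Setoid)
open import Relation.Binary.PropositionalEquality
  using (_≡_; sym; cong; subst; module ≡-Reasoning)
import Relation.Binary.Reasoning.Setoid as SetoidReasoning
open import Algebra.Bundles using (Group)
open import Algebra.Structures using (IsGroup)
import Algebra.Properties.Group as GroupProperties

-- A matrix is strictly group-developed iff permuting its columns by g ↦ g⁻¹
-- puts it in C(R): the centraliser of the right regular representation
-- consists exactly of the matrices [h(xy⁻¹)], with h read off the column of ε.
-- Permuting columns is multiplication by a monomial matrix, so it preserves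
-- 𝒜-equivalence classes.

module _ {m : ℕ} where

  ≈-refl : ∀ {a} → a ≈[ m ] a
  ≈-refl {a} = subst (m ℕ.∣_) (sym (cong ∣_∣ (+-inverseʳ a))) (m ℕ.∣0)

  ≈-sym : ∀ {a b} → a ≈[ m ] b → b ≈[ m ] a
  ≈-sym {a} {b} = subst (m ℕ.∣_) (∣i-j∣≡∣j-i∣ a b)

  ≈-trans : ∀ {a b c} → a ≈[ m ] b → b ≈[ m ] c → a ≈[ m ] c
  ≈-trans {a} {b} {c} a≈b b≈c =
    Signed.∣⇒∣ᵤ (subst (+ m Signed.∣_) (telescope a b c)
                   (Signed.∣m∣n⇒∣m+n (Signed.∣ᵤ⇒∣ {+ m} {a - b} a≈b) (Signed.∣ᵤ⇒∣ {+ m} {b - c} b≈c)))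
    where
    telescope : ∀ x y z → (x - y) + (y - z) ≡ x - z
    telescope = solve-∀

congruenceSetoid : ℕ → Setoid _ _
congruenceSetoid m = record
  { Carrier       = ℤ
  ; _≈_           = _≈[ m ]_
  ; isEquivalence = record
      { refl  = λ {a} → ≈-refl {m} {a}
      ; sym   = λ {a} {b} → ≈-sym {m} {a} {b}
      ; trans = λ {a} {b} {c} → ≈-trans {m} {a} {b} {c}
      }
  }

module _ {n : ℕ} (G : FinGroup n) where
  open FinGroup G
  group : Group _ _
  group = record { isGroup = isGroup }

  open GroupProperties group using (⁻¹-involutive; ⁻¹-anti-homo-∙; //-rightDividesˡ)
  open IsGroup isGroup using (assoc; inverseʳ)

  inversion : Permutation′ n
  inversion = permutation _⁻¹ _⁻¹ ⁻¹-involutive ⁻¹-involutive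

  invertColumns : AMat n → AMat n
  invertColumns X x y = X x (y ⁻¹)

  x∙[y∙g⁻¹]⁻¹≡[x∙g]∙y⁻¹ : ∀ x y g → x ∙ ((y ∙ (g ⁻¹)) ⁻¹) ≡ (x ∙ g) ∙ (y ⁻¹)
  x∙[y∙g⁻¹]⁻¹≡[x∙g]∙y⁻¹ x y g = begin
    x ∙ ((y ∙ (g ⁻¹)) ⁻¹)      ≡⟨ cong (x ∙_) (⁻¹-anti-homo-∙ y (g ⁻¹)) ⟩
    x ∙ (((g ⁻¹) ⁻¹) ∙ (y ⁻¹)) ≡⟨ cong (λ h → x ∙ (h ∙ (y ⁻¹))) (⁻¹-involutive g) ⟩
    x ∙ (g ∙ (y ⁻¹))           ≡⟨ assoc x g (y ⁻¹) ⟨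
    (x ∙ g) ∙ (y ⁻¹)           ∎
    where open ≡-Reasoning

  module _ (m : ℕ) where

    AEquivalent-invertColumns : ∀ {M N} → AEquivalent m M N → AEquivalent m M (invertColumns N)
    AEquivalent-invertColumns (P , mono τ q , N≋PMQ*) =
      P , mono (inversion ∘ₚ τ) (λ y → q (y ⁻¹)) , λ x y → N≋PMQ* x (y ⁻¹)

    strictlyGroupDeveloped⇒invertColumns-inCentraliser :
      ∀ {N} → StrictlyGroupDeveloped G m N → InCentraliser G m (invertColumns N)
    strictlyGroupDeveloped⇒invertColumns-inCentraliser {N} (f , N≋f[x∙y]) g x y = begin
      N x ((y ∙ (g ⁻¹)) ⁻¹)      ≈⟨ N≋f[x∙y] x _ ⟩
      f (x ∙ ((y ∙ (g ⁻¹)) ⁻¹))  ≡⟨ cong f (x∙[y∙g⁻¹]⁻¹≡[x∙g]∙y⁻¹ x y g) ⟩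
      f ((x ∙ g) ∙ (y ⁻¹))       ≈⟨ N≋f[x∙y] (x ∙ g) (y ⁻¹) ⟨
      N (x ∙ g) (y ⁻¹)           ∎
      where open SetoidReasoning (congruenceSetoid m)

    inCentraliser⇒X[a,b]≈X[a∙b⁻¹,ε] :
      ∀ {X} → InCentraliser G m X → ∀ a b → X a b ≈[ m ] X (a ∙ (b ⁻¹)) ε
    inCentraliser⇒X[a,b]≈X[a∙b⁻¹,ε] {X} XR≋RX a b = begin
      X a b                       ≡⟨ cong (λ z → X z b) (//-rightDividesˡ b a) ⟨
      X ((a ∙ (b ⁻¹)) ∙ b) b      ≈⟨ XR≋RX b (a ∙ (b ⁻¹)) b ⟨
      X (a ∙ (b ⁻¹)) (b ∙ (b ⁻¹)) ≡⟨ cong (X (a ∙ (b ⁻¹))) (inverseʳ b) ⟩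
      X (a ∙ (b ⁻¹)) ε            ∎
      where open SetoidReasoning (congruenceSetoid m)

    inCentraliser⇒invertColumns-strictlyGroupDeveloped :
      ∀ {X} → InCentraliser G m X → StrictlyGroupDeveloped G m (invertColumns X)
    inCentraliser⇒invertColumns-strictlyGroupDeveloped {X} XR≋RX = (λ z → X z ε) , λ x y → begin
      X x (y ⁻¹)               ≈⟨ inCentraliser⇒X[a,b]≈X[a∙b⁻¹,ε] {X} XR≋RX x (y ⁻¹) ⟩
      X (x ∙ ((y ⁻¹) ⁻¹)) ε    ≡⟨ cong (λ z → X (x ∙ z) ε) (⁻¹-involutive y) ⟩
      X (x ∙ y) ε              ∎
      where open SetoidReasoning (congruenceSetoid m)

theorem4p2 : (m : ℕ) → 1 ≤ m → (n : ℕ) → (G : FinGroup n) → (M : AMat n) →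
    GroupDeveloped G m M ⇔ Σ (AMat n) (λ X → AEquivalent m M X × InCentraliser G m X)
theorem4p2 m _ n G M = mk⇔
  (λ (N , M~N , N-developed) →
     invertColumns G N , AEquivalent-invertColumns G m {M} {N} M~N ,
     strictlyGroupDeveloped⇒invertColumns-inCentraliser G m {N} N-developed)
  (λ (X , M~X , X∈C[R]) →
     invertColumns G X , AEquivalent-invertColumns G m {M} {X} M~X ,
     inCentraliser⇒invertColumns-strictlyGroupDeveloped G m {X} X∈C[R])
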